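{- A set of formulas of $\mathcal{L}_{\mathsf{DPL}}$ is saturated if and only if it is maximally consistent in $\mathcal{H}_{\mathsf{DPL}}$ (i.e. consistent and not properly contained in any consistent set of formulas).
   Context: Let $\mathbb{P}$ be a countable set of propositional variables. The formulas of $\mathcal{L}_{\mathsf{DPL}}$ are given by $\varphi ::= p \mid \neg\varphi \mid \varphi\wedge\varphi \mid L_r\varphi \mid \bigcirc\varphi$ with $p\in\mathbb{P}$, $r\in\mathbb{Q}\cap[0,1]$; $\bigcirc^n$ is $n$-fold iteration of $\bigcirc$; $L_{r_1}\cdots L_{r_k}L_s\varphi$ denotes iterated application ($k\ge 0$). The Hilbert system $\mathcal{H}_{\mathsf{DPL}}$ has the axiom schemes: propositional tautologies; $L_0\bot$; $L_r\neg\varphi\to\neg L_s\varphi$ if $r+s>1$; $L_r(\varphi\wedge\psi)\wedge L_s(\varphi\wedge\neg\psi)\to L_{r+s}\varphi$ if $r+s\le 1$; $\neg L_r(\varphi\wedge\psi)\wedge\neg L_s(\varphi\wedge\neg\psi)\to\neg L_{r+s}\varphi$ if $r+s\le1$; $L_1(\varphi\to\psi)\to(L_r\varphi\to L_r\psi)$; $\bigcirc\neg\varphi\leftrightarrow\neg\bigcirc\varphi$; $\bigcirc(\varphi\wedge\psi)\leftrightarrow(\bigcirc\varphi\wedge\bigcirc\psi)$; and rules: modus ponens; the generalized Archimedean rule: for $n,k\in\mathbb{N}$, $r_1,\dots,r_k,r\in\mathbb{Q}\cap[0,1]$, from $\{\psi\to\bigcirc^nL_{r_1}\cdots L_{r_k}L_s\varphi\mid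 s<r,\ s\in\mathbb{Q}\cap[0,1]\}$ infer $\psi\to\bigcirc^nL_{r_1}\cdots L_{r_k}L_r\varphi$; from $\varphi$ infer $L_1\varphi$; from $\varphi$ infer $\bigcirc\varphi$. A theorem is the last element of a sequence $(\varphi_\beta)_{\beta\le\alpha+1}$ ($\alpha$ a countable ordinal) each element an axiom or obtained by a rule from earlier elements; $\Gamma\vdash\varphi$ means such a sequence ending in $\varphi$ each element of which is in $\Gamma$, a theorem, or obtained from earlier elements by a rule other than the two necessitation rules. $\Gamma$ is consistent if $\Gamma\nvdash\bot$, finitely consistent if each finite subset is consistent. A set $w$ of formulas is saturated if (i) $w$ is finitely consistent, (ii) for every formula $\varphi$, $\varphi\in w$ or $\neg\varphi\in w$, and (iii) for all $\varphi$, $n,k\in\mathbb{N}$, $r_1,\dots,r_k,r\in\mathbb{Q}\cap[0,1]$: if $\bigcirc^nL_{r_1}\cdots L_{r_k}L_s\varphi\in w$ for all rational $s<r$, then $\bigcirc^nL_{r_1}\cdots L_{r_k}L_r\varphi\in w$. -}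

module Defs where

open import Data.Nat using (ℕ; zero; suc)
open import Data.Bool using (Bool; true; false; not; _∧_)
open import Data.List using (List; []; _∷_; foldr)
open import Data.List.Relation.Unary.All using (All)
open import Data.List.Relation.Unary.Any using (Any)
open import Data.Rational using (ℚ; 0ℚ; 1ℚ; _≤_; _<_; _+_)
open import Data.Product using (_×_; ∃)
open import Data.Sum using (_⊎_)
open import Data.Empty using (⊥)
open import Relation.Binary.PropositionalEquality using (_≡_)
open import Relation.Nullary using (¬_)

-- Rationals in [0,1] (bounds are irrelevant, so equal values give equal indices)
record Q01 : Set where
  constructor ⟨_⟩
  field
    val : ℚ
    .lo : 0ℚ ≤ val
    .hi : val ≤ 1ℚ
open Q01 public

infix 8 ¬'_
infixr 6 _∧'_
infixr 4 _⇒_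
infix 3 _⇔_
data Formula : Set where
  var  : ℕ → Formula
  ¬'_  : Formula → Formula
  _∧'_ : Formula → Formula → Formula
  L    : Q01 → Formula → Formula
  ○    : Formula → Formula

_⇒_ : Formula → Formula → Formula
φ ⇒ ψ = ¬' (φ ∧' ¬' ψ)

_⇔_ : Formula → Formula → Formula
φ ⇔ ψ = (φ ⇒ ψ) ∧' (ψ ⇒ φ)

⊥' : Formula
⊥' = var 0 ∧' ¬' var 0

○^ : ℕ → Formula → Formula
○^ zero φ = φ
○^ (suc n) φ = ○ (○^ n φ)

Ls : List Q01 → Formula → Formula
Ls rs φ = foldr L φ rs

eval : (Formula → Bool) → Formula → Bool
eval v (var p)   = v (var p)
eval v (¬' φ)    = not (eval v φ)
eval v (φ ∧' ψ)  = eval v φ ∧ eval v ψ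
eval v (L r φ)   = v (L r φ)
eval v (○ φ)     = v (○ φ)

Tautology : Formula → Set
Tautology φ = ∀ (v : Formula → Bool) → eval v φ ≡ true

data Axiom : Formula → Set where
  taut   : ∀ {φ} → Tautology φ → Axiom φ
  L0⊥    : (z : Q01) → val z ≡ 0ℚ → Axiom (L z ⊥')
  Lneg   : ∀ {φ} (r s : Q01) → 1ℚ < val r + val s → Axiom (L r (¬' φ) ⇒ ¬' L s φ)
  Ladd   : ∀ {φ ψ} (r s t : Q01) → val r + val s ≤ 1ℚ → val t ≡ val r + val s →
           Axiom ((L r (φ ∧' ψ) ∧' L s (φ ∧' ¬' ψ)) ⇒ L t φ)
  LaddN  : ∀ {φ ψ} (r s t : Q01) → val r + val s ≤ 1ℚ → val t ≡ val r + val s →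
           Axiom ((¬' L r (φ ∧' ψ) ∧' ¬' L s (φ ∧' ¬' ψ)) ⇒ ¬' L t φ)
  LK     : ∀ {φ ψ} (one r : Q01) → val one ≡ 1ℚ →
           Axiom (L one (φ ⇒ ψ) ⇒ (L r φ ⇒ L r ψ))
  ○neg   : ∀ {φ} → Axiom (○ (¬' φ) ⇔ ¬' ○ φ)
  ○and   : ∀ {φ ψ} → Axiom (○ (φ ∧' ψ) ⇔ (○ φ ∧' ○ ψ))

data Thm : Formula → Set where
  ax    : ∀ {φ} → Axiom φ → Thm φ
  mp    : ∀ {φ ψ} → Thm φ → Thm (φ ⇒ ψ) → Thm ψ
  arch  : ∀ {ψ φ} (n : ℕ) (rs : List Q01) (r : Q01) →
          ((s : Q01) → val s < val r → Thm (ψ ⇒ ○^ n (Ls rs (L s φ)))) →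
          Thm (ψ ⇒ ○^ n (Ls rs (L r φ)))
  necL  : ∀ {φ} (one : Q01) → val one ≡ 1ℚ → Thm φ → Thm (L one φ)
  nec○  : ∀ {φ} → Thm φ → Thm (○ φ)

FSet : Set₁
FSet = Formula → Set

-- Derivability from assumptions (no necessitation on assumptions)
data _⊢_ (Γ : FSet) : Formula → Set where
  assum : ∀ {φ} → Γ φ → Γ ⊢ φ
  thm   : ∀ {φ} → Thm φ → Γ ⊢ φ
  mp    : ∀ {φ ψ} → Γ ⊢ φ → Γ ⊢ (φ ⇒ ψ) → Γ ⊢ ψ
  arch  : ∀ {ψ φ} (n : ℕ) (rs : List Q01) (r : Q01) →
          ((s : Q01) → val s < val r → Γ ⊢ (ψ ⇒ ○^ n (Ls rs (L s φ)))) →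
          Γ ⊢ (ψ ⇒ ○^ n (Ls rs (L r φ)))

Consistent : FSet → Set
Consistent Γ = ¬ (Γ ⊢ ⊥')

⟦_⟧ : List Formula → FSet
⟦ Δ ⟧ φ = Any (φ ≡_) Δ

FinitelyConsistent : FSet → Set
FinitelyConsistent Γ = ∀ (Δ : List Formula) → All Γ Δ → Consistent ⟦ Δ ⟧

Saturated : FSet → Set
Saturated w =
  FinitelyConsistent w ×
  (∀ φ → w φ ⊎ w (¬' φ)) ×
  (∀ φ (n : ℕ) (rs : List Q01) (r : Q01) →
     ((s : Q01) → val s < val r → w (○^ n (Ls rs (L s φ)))) →
     w (○^ n (Ls rs (L r φ))))

_⊆_ : FSet → FSet → Set
Γ ⊆ Δ = ∀ {φ} → Γ φ → Δ φ

MaximallyConsistent : FSet → Set₁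
MaximallyConsistent w =
  Consistent w ×
  (∀ (Γ : FSet) → Consistent Γ → w ⊆ Γ → ¬ (Σ' Γ))
  where
    Σ' : FSet → Set
    Σ' Γ = ∃ λ φ → Γ φ × ¬ w φ

-- Both directions go through deductive closure. A saturated set w is closed under ⊢
-- by induction on derivations: every rule instance has finitely many premises, and
-- finite consistency together with completeness puts every consequence of finitely
-- many members of w into w; the one infinitary rule, the Archimedean rule, is matched
-- by clause (iii). Conversely, a maximally consistent set is (classically) closed
-- under ⊢ and complete by the deduction theorem, and any deductively closed set
-- satisfies (iii) by applying the Archimedean rule with a tautological antecedent.
module Submission where

open import Defs
open import Level using (0ℓ)
open import Axiom.ExcludedMiddle using (ExcludedMiddle)
open import Function.Bundles renaming (_⇔_ to _⟺_)
open import Data.Bool using (true; false)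
open import Data.Empty using (⊥-elim)
open import Data.List using (List; []; _∷_)
open import Data.List.Relation.Unary.All using (All; []; _∷_)
open import Data.List.Relation.Unary.Any using (here; there)
open import Data.Nat using (ℕ)
open import Data.Product using (_×_; _,_; ∃; proj₁; proj₂)
open import Data.Rational using (_<_)
open import Data.Sum using (_⊎_; inj₁; inj₂)
open import Relation.Binary.PropositionalEquality using (_≡_; refl)
open import Relation.Nullary using (¬_; yes; no)
open import Relation.Nullary.Decidable using (decidable-stable)

I-taut : ∀ φ → Tautology (φ ⇒ φ)
I-taut φ v with eval v φ
... | false = refl
... | true  = refl

K-taut : ∀ φ ψ → Tautology (φ ⇒ ψ ⇒ φ)
K-taut φ ψ v with eval v φ | eval v ψ
... | false | _     = refl
... | true  | false = refl
... | true  | true  = refl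

S-taut : ∀ χ φ ψ → Tautology ((χ ⇒ φ) ⇒ (χ ⇒ φ ⇒ ψ) ⇒ χ ⇒ ψ)
S-taut χ φ ψ v with eval v χ | eval v φ | eval v ψ
... | false | _     | _     = refl
... | true  | false | _     = refl
... | true  | true  | false = refl
... | true  | true  | true  = refl

uncurry-taut : ∀ χ φ ψ → Tautology ((χ ⇒ φ ⇒ ψ) ⇒ χ ∧' φ ⇒ ψ)
uncurry-taut χ φ ψ v with eval v χ | eval v φ | eval v ψ
... | false | _     | _     = refl
... | true  | false | _     = refl
... | true  | true  | false = refl
... | true  | true  | true  = refl

curry-taut : ∀ χ φ ψ → Tautology ((χ ∧' φ ⇒ ψ) ⇒ χ ⇒ φ ⇒ ψ)
curry-taut χ φ ψ v with eval v χ | eval v φ | eval v ψ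
... | false | _     | _     = refl
... | true  | false | _     = refl
... | true  | true  | false = refl
... | true  | true  | true  = refl

explosion-taut : ∀ φ ψ → Tautology (φ ⇒ ¬' φ ⇒ ψ)
explosion-taut φ ψ v with eval v φ | eval v ψ
... | false | _     = refl
... | true  | false = refl
... | true  | true  = refl

refutation-taut : ∀ φ → Tautology ((φ ⇒ ⊥') ⇒ ¬' φ)
refutation-taut φ v with eval v φ | v (var 0)
... | false | _     = refl
... | true  | false = refl
... | true  | true  = refl

⊢-taut : ∀ {Γ φ} → Tautology φ → Γ ⊢ φ
⊢-taut t = thm (ax (taut t))

⊢-weaken : ∀ {Γ φ ψ} → Γ ⊢ φ → Γ ⊢ (ψ ⇒ φ)
⊢-weaken {φ = φ} {ψ} ⊢φ = mp ⊢φ (⊢-taut (K-taut φ ψ))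

⊢-explosion : ∀ {Γ φ ψ} → Γ ⊢ φ → Γ ⊢ (¬' φ) → Γ ⊢ ψ
⊢-explosion {φ = φ} {ψ} ⊢φ ⊢¬φ = mp ⊢¬φ (mp ⊢φ (⊢-taut (explosion-taut φ ψ)))

⊢-mono : ∀ {Γ Δ φ} → Γ ⊆ Δ → Γ ⊢ φ → Δ ⊢ φ
⊢-mono Γ⊆Δ (assum γ)       = assum (Γ⊆Δ γ)
⊢-mono Γ⊆Δ (thm t)         = thm t
⊢-mono Γ⊆Δ (mp d e)        = mp (⊢-mono Γ⊆Δ d) (⊢-mono Γ⊆Δ e)
⊢-mono Γ⊆Δ (arch n rs r f) = arch n rs r λ s s<r → ⊢-mono Γ⊆Δ (f s s<r)

infixl 5 _,,_
_,,_ : FSet → Formula → FSet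
(Γ ,, χ) φ = Γ φ ⊎ φ ≡ χ

-- The Archimedean case survives because the rule may carry the hypothesis χ
-- inside its antecedent: χ ⇒ ψ ⇒ X is traded for χ ∧' ψ ⇒ X and back.
deduction : ∀ {Γ χ θ} → (Γ ,, χ) ⊢ θ → Γ ⊢ (χ ⇒ θ)
deduction {χ = χ} (assum (inj₂ refl)) = ⊢-taut (I-taut χ)
deduction (assum (inj₁ γ)) = ⊢-weaken (assum γ)
deduction (thm t)          = ⊢-weaken (thm t)
deduction {χ = χ} {θ} (mp {φ = φ} d e) =
  mp (deduction e) (mp (deduction d) (⊢-taut (S-taut χ φ θ)))
deduction {χ = χ} (arch {ψ = ψ} {φ = φ} n rs r f) =
  mp (arch {ψ = χ ∧' ψ} n rs r λ s s<r →
        mp (deduction (f s s<r)) (⊢-taut (uncurry-taut χ ψ (○^ n (Ls rs (L s φ))))))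
     (⊢-taut (curry-taut χ ψ (○^ n (Ls rs (L r φ)))))

All⇒⊆ : ∀ {w : FSet} {Δ} → All w Δ → ⟦ Δ ⟧ ⊆ w
All⇒⊆ (wφ ∷ _)  (here refl) = wφ
All⇒⊆ (_ ∷ wΔ) (there φ∈Δ) = All⇒⊆ wΔ φ∈Δ

Complete : FSet → Set
Complete w = ∀ φ → w φ ⊎ w (¬' φ)

ArchimedeanClosed : FSet → Set
ArchimedeanClosed w =
  ∀ φ (n : ℕ) (rs : List Q01) (r : Q01) →
  ((s : Q01) → val s < val r → w (○^ n (Ls rs (L s φ)))) →
  w (○^ n (Ls rs (L r φ)))

DeductivelyClosed : FSet → Set
DeductivelyClosed w = ∀ {χ} → w ⊢ χ → w χ

module _ {w : FSet} (w-finCon : FinitelyConsistent w) (w-complete : Complete w) where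

  finitelyDerivable⇒∈ : ∀ {Δ χ} → All w Δ → ⟦ Δ ⟧ ⊢ χ → w χ
  finitelyDerivable⇒∈ {Δ} {χ} wΔ ⊢χ with w-complete χ
  ... | inj₁ χ∈w  = χ∈w
  ... | inj₂ ¬χ∈w = ⊥-elim (w-finCon (¬' χ ∷ Δ) (¬χ∈w ∷ wΔ)
                      (⊢-explosion (⊢-mono there ⊢χ) (assum (here refl))))

  ∈-mp : ∀ {φ ψ} → w φ → w (φ ⇒ ψ) → w ψ
  ∈-mp φ∈w φ⇒ψ∈w = finitelyDerivable⇒∈ (φ∈w ∷ φ⇒ψ∈w ∷ [])
    (mp (assum (here refl)) (assum (there (here refl))))

  ∈-weaken : ∀ {φ ψ} → w φ → w (ψ ⇒ φ)
  ∈-weaken φ∈w = finitelyDerivable⇒∈ (φ∈w ∷ []) (⊢-weaken (assum (here refl)))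

  ∈-vacuous : ∀ {φ ψ} → w (¬' ψ) → w (ψ ⇒ φ)
  ∈-vacuous ¬ψ∈w = finitelyDerivable⇒∈ (¬ψ∈w ∷ [])
    (deduction (⊢-explosion (assum (inj₂ refl)) (assum (inj₁ (here refl)))))

  archimedeanClosed⇒deductivelyClosed : ArchimedeanClosed w → DeductivelyClosed w
  archimedeanClosed⇒deductivelyClosed w-arch = closed
    where
    closed : DeductivelyClosed w
    closed (assum χ∈w) = χ∈w
    closed (thm t)     = finitelyDerivable⇒∈ [] (thm t)
    closed (mp d e)    = ∈-mp (closed d) (closed e)
    closed (arch {ψ = ψ} {φ = φ} n rs r f) with w-complete ψ
    ... | inj₂ ¬ψ∈w = ∈-vacuous ¬ψ∈w
    ... | inj₁ ψ∈w  = ∈-weaken (w-arch φ n rs r λ s s<r → ∈-mp ψ∈w (closed (f s s<r)))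

saturated⇒maximallyConsistent : ∀ {w} → Saturated w → MaximallyConsistent w
saturated⇒maximallyConsistent {w} (w-finCon , w-complete , w-arch) = consistent , maximal
  where
  consistent : Consistent w
  consistent ⊢⊥ = w-finCon (⊥' ∷ [])
    (archimedeanClosed⇒deductivelyClosed w-finCon w-complete w-arch ⊢⊥ ∷ [])
    (assum (here refl))

  maximal : ∀ Γ → Consistent Γ → w ⊆ Γ → ¬ (∃ λ φ → Γ φ × ¬ w φ)
  maximal Γ Γ-con w⊆Γ (φ , φ∈Γ , φ∉w) with w-complete φ
  ... | inj₁ φ∈w  = φ∉w φ∈w
  ... | inj₂ ¬φ∈w = Γ-con (⊢-explosion (assum φ∈Γ) (assum (w⊆Γ ¬φ∈w)))

consistent⇒finitelyConsistent : ∀ {w} → Consistent w → FinitelyConsistent w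
consistent⇒finitelyConsistent w-con Δ wΔ ⊢⊥ = w-con (⊢-mono (All⇒⊆ wΔ) ⊢⊥)

deductivelyClosed⇒archimedeanClosed : ∀ {w} → DeductivelyClosed w → ArchimedeanClosed w
deductivelyClosed⇒archimedeanClosed closed φ n rs r X∈w =
  closed (mp (⊢-taut (I-taut ⊥'))
    (arch {ψ = ⊥' ⇒ ⊥'} {φ = φ} n rs r λ s s<r → ⊢-weaken (assum (X∈w s s<r))))

module _ (em : ExcludedMiddle 0ℓ) {w : FSet} (w-maxCon : MaximallyConsistent w) where

  consistentExtension⇒∈ : ∀ {χ} → Consistent (w ,, χ) → w χ
  consistentExtension⇒∈ {χ} con = decidable-stable em λ χ∉w →
    proj₂ w-maxCon (w ,, χ) con inj₁ (χ , inj₂ refl , χ∉w)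

  maximallyConsistent⇒deductivelyClosed : DeductivelyClosed w
  maximallyConsistent⇒deductivelyClosed ⊢χ =
    consistentExtension⇒∈ λ ⊢⊥ → proj₁ w-maxCon (mp ⊢χ (deduction ⊢⊥))

  maximallyConsistent⇒complete : Complete w
  maximallyConsistent⇒complete φ with em {w φ}
  ... | yes φ∈w = inj₁ φ∈w
  ... | no  φ∉w = inj₂ (maximallyConsistent⇒deductivelyClosed
                    (mp (deduction ⊢⊥) (⊢-taut (refutation-taut φ))))
    where
    ⊢⊥ : (w ,, φ) ⊢ ⊥'
    ⊢⊥ = decidable-stable em λ con → φ∉w (consistentExtension⇒∈ con)

  maximallyConsistent⇒saturated : Saturated w
  maximallyConsistent⇒saturated =
    consistent⇒finitelyConsistent (proj₁ w-maxCon) ,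
    maximallyConsistent⇒complete ,
    deductivelyClosed⇒archimedeanClosed maximallyConsistent⇒deductivelyClosed

corollary3p7 : ExcludedMiddle 0ℓ → (w : FSet) → Saturated w ⟺ MaximallyConsistent w
corollary3p7 em w = mk⇔ saturated⇒maximallyConsistent (maximallyConsistent⇒saturated em)
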